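{- Let $Q$ be a commutative involutive quantale and $X$ a set. Every object $\mathbf{A}$ of $\mathbf{Rel}_Q\text{ - }\mathbf{Alg}_{\mathrm{vN}}(X)$ is a subquantale of $\mathrm{Hom}(X,X)$, i.e. $\mathbf{A}$ is closed under arbitrary (pointwise) joins of arbitrary subsets, under composition, and contains $\mathrm{id}_X$.
   Context: A commutative involutive quantale $(Q,\bigvee,\cdot,1_Q,{}^*)$ is a complete join-semilattice with a commutative monoid operation $\cdot$ (unit $1_Q$) distributing over arbitrary joins on both sides, together with an involution ${}^*$ that preserves joins and satisfies $(x\cdot y)^*=y^*\cdot x^*$, $1_Q^*=1_Q$. Its least element (the empty join) is denoted $0$; it is assumed that $0\neq\top$. The category $\mathbf{Rel}_Q$ has sets as objects; a morphism $f:X\to Y$ is a function $f:X\times Y\to Q$, composition is $(g\circ f)(x,z)=\bigvee_{y\in Y} f(x,y)\cdot g(y,z)$, identities are $\mathrm{id}_X(x,y)=1_Q$ if $x=y$ and $0$ otherwise, and the dagger is $f^\dagger(y,x)=f(x,y)^*$. Each $\mathrm{Hom}(X,X)$ is a semialgebra over the semiring $Q$ (addition $=$ pointwise join, zero $=$ constant $0$ map, multiplication $=$ composition, scalar multiplication $(q\bullet f)(x,y)=q\cdot f(x,y)$, involution $=\dagger$). For $B\subseteq \mathrm{Hom}(X,X)$ its commutant is $B'=\{f : f\circ g=g\circ f \text{ for all } g\in B\}$. $\mathbf{Rel}_Q\text{ - }\mathbf{Alg}_{\mathrm{vN}}(X)$ is the category (poset under inclusion) whose objects are the subsets $\mathbf{A}\subseteq\mathrm{Hom}(X,X)$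 which contain $0$ and $\mathrm{id}_X$, are closed under binary pointwise joins, composition, scalar multiplication by elements of $Q$ and $\dagger$, are commutative under composition, and satisfy $\mathbf{A}=\mathbf{A}''$ (von Neumann condition). -}

module Defs where

open import Level using (0ℓ)
open import Data.Bool using (Bool; true; false; if_then_else_)
open import Data.Empty using (⊥)
open import Data.Product using (Σ; _×_; proj₁)
open import Relation.Nullary using (¬_)
open import Relation.Unary using (Pred; _∈_)
open import Relation.Binary.PropositionalEquality using (_≡_)
open import Relation.Binary.Structures using (IsPartialOrder)

-- A commutative involutive quantale. Joins are indexed by arbitrary
-- families I → Q with I : Set (equivalently, joins of arbitrary subsets).
record CIQuantale : Set₁ where
  infixl 7 _·_
  field
    Carrier   : Set
    _≤_       : Carrier → Carrier → Set
    ≤-isPO    : IsPartialOrder _≡_ _≤_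
    ⋁         : {I : Set} → (I → Carrier) → Carrier
    ⋁-ub      : {I : Set} (f : I → Carrier) (i : I) → f i ≤ ⋁ f
    ⋁-least   : {I : Set} (f : I → Carrier) (x : Carrier) →
                (∀ i → f i ≤ x) → ⋁ f ≤ x
    _·_       : Carrier → Carrier → Carrier
    1Q        : Carrier
    ·-assoc   : ∀ x y z → (x · y) · z ≡ x · (y · z)
    ·-comm    : ∀ x y → x · y ≡ y · x
    ·-identityˡ : ∀ x → 1Q · x ≡ x
    ·-identityʳ : ∀ x → x · 1Q ≡ x
    ·-distribˡ-⋁ : {I : Set} (x : Carrier) (f : I → Carrier) →
                   x · ⋁ f ≡ ⋁ (λ i → x · f i)
    ·-distribʳ-⋁ : {I : Set} (f : I → Carrier) (x : Carrier) →
                   ⋁ f · x ≡ ⋁ (λ i → f i · x)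
    _*        : Carrier → Carrier
    *-involutive : ∀ x → (x *) * ≡ x
    *-⋁       : {I : Set} (f : I → Carrier) → (⋁ f) * ≡ ⋁ (λ i → f i *)
    *-·       : ∀ x y → (x · y) * ≡ (y *) · (x *)
    *-1       : 1Q * ≡ 1Q
    0≢⊤       : ¬ (⋁ {⊥} (λ ()) ≡ ⋁ {Carrier} (λ x → x))

module RelQ (Q : CIQuantale) (X : Set) where
  open CIQuantale Q

  0Q : Carrier
  0Q = ⋁ {⊥} (λ ())

  Hom : Set
  Hom = X → X → Carrier

  -- composition g ∘ f, written f ⨾ g : (f ⨾ g)(x,z) = ⋁_y f(x,y)·g(y,z)
  _⨾_ : Hom → Hom → Hom
  (f ⨾ g) x z = ⋁ {X} (λ y → f x y · g y z)

  -- identity: id(x,y) = ⋁_{x ≡ y} 1, i.e. 1 if x = y and 0 otherwise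
  idR : Hom
  idR x y = ⋁ {x ≡ y} (λ _ → 1Q)

  zeroR : Hom
  zeroR x y = 0Q

  _∨R_ : Hom → Hom → Hom
  (f ∨R g) x y = ⋁ {Bool} (λ b → if b then f x y else g x y)

  _•_ : Carrier → Hom → Hom
  (q • f) x y = q · f x y

  _† : Hom → Hom
  (f †) x y = (f y x) *

  ⋁R : Pred Hom 0ℓ → Hom
  ⋁R S x y = ⋁ {Σ Hom S} (λ p → proj₁ p x y)

  _≐_ : Hom → Hom → Set
  f ≐ g = ∀ x y → f x y ≡ g x y

  _′ : Pred Hom 0ℓ → Pred Hom 0ℓ
  (B ′) f = ∀ g → g ∈ B → (g ⨾ f) ≐ (f ⨾ g)

  record IsVNAlg (A : Pred Hom 0ℓ) : Set where
    field
      zero∈ : zeroR ∈ A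
      id∈   : idR ∈ A
      ∨-closed : ∀ f g → f ∈ A → g ∈ A → (f ∨R g) ∈ A
      ⨾-closed : ∀ f g → f ∈ A → g ∈ A → (f ⨾ g) ∈ A
      •-closed : ∀ q f → f ∈ A → (q • f) ∈ A
      †-closed : ∀ f → f ∈ A → (f †) ∈ A
      commutative : ∀ f g → f ∈ A → g ∈ A → (f ⨾ g) ≐ (g ⨾ f)
      vN⊆ : ∀ f → f ∈ A → f ∈ ((A ′) ′)
      vN⊇ : ∀ f → f ∈ ((A ′) ′) → f ∈ A

  IsSubquantale : Pred Hom 0ℓ → Set₁
  IsSubquantale A =
    (∀ (S : Pred Hom 0ℓ) → (∀ f → f ∈ S → f ∈ A) → ⋁R S ∈ A)
    × (∀ f g → f ∈ A → g ∈ A → (f ⨾ g) ∈ A)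
    × idR ∈ A

module Submission where

open import Level using (0ℓ)
open import Relation.Unary using (Pred; _∈_; _⊆_)
open import Data.Product using (Σ; _,_; proj₁; proj₂)
open import Relation.Binary.PropositionalEquality using (_≡_; sym; module ≡-Reasoning)
open import Relation.Binary.Structures using (IsPartialOrder)
open import Defs

-- Composition distributes over arbitrary pointwise joins on both sides, so if
-- every member of S commutes with g then so does ⋁R S: the commutant of any set
-- is join-closed. A von Neumann algebra is the commutant of A ′, hence
-- join-closed; composition and the identity are part of its definition.

module JoinLemmas (Q : CIQuantale) where
  open CIQuantale Q
  open IsPartialOrder ≤-isPO using (antisym; reflexive; trans)

  ⋁-mono : {I : Set} {f g : I → Carrier} → (∀ i → f i ≤ g i) → ⋁ f ≤ ⋁ g
  ⋁-mono {g = g} f≤g = ⋁-least _ (⋁ g) (λ i → trans (f≤g i) (⋁-ub g i))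

  ⋁-cong : {I : Set} {f g : I → Carrier} → (∀ i → f i ≡ g i) → ⋁ f ≡ ⋁ g
  ⋁-cong f≡g = antisym (⋁-mono (λ i → reflexive (f≡g i)))
                       (⋁-mono (λ i → reflexive (sym (f≡g i))))

  ⋁-comm-≤ : {I J : Set} (h : I → J → Carrier) →
             ⋁ (λ i → ⋁ (λ j → h i j)) ≤ ⋁ (λ j → ⋁ (λ i → h i j))
  ⋁-comm-≤ h = ⋁-least _ _ λ i → ⋁-least _ _ λ j →
    trans (⋁-ub (λ i′ → h i′ j) i) (⋁-ub (λ j′ → ⋁ (λ i′ → h i′ j′)) j)

  ⋁-comm : {I J : Set} (h : I → J → Carrier) →
           ⋁ (λ i → ⋁ (λ j → h i j)) ≡ ⋁ (λ j → ⋁ (λ i → h i j))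
  ⋁-comm h = antisym (⋁-comm-≤ h) (⋁-comm-≤ (λ j i → h i j))

module CommutantLemmas (Q : CIQuantale) (X : Set) where
  open CIQuantale Q
  open RelQ Q X
  open JoinLemmas Q

  ⨾-distribˡ-⋁R : (g : Hom) (S : Pred Hom 0ℓ) →
                  (g ⨾ ⋁R S) ≐ (λ x z → ⋁ {Σ Hom S} (λ p → (g ⨾ proj₁ p) x z))
  ⨾-distribˡ-⋁R g S x z = begin
    ⋁ (λ y → g x y · ⋁ (λ p → proj₁ p y z))   ≡⟨ ⋁-cong (λ y → ·-distribˡ-⋁ (g x y) _) ⟩
    ⋁ (λ y → ⋁ (λ p → g x y · proj₁ p y z))   ≡⟨ ⋁-comm _ ⟩
    ⋁ (λ p → ⋁ (λ y → g x y · proj₁ p y z))   ∎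
    where open ≡-Reasoning

  ⨾-distribʳ-⋁R : (S : Pred Hom 0ℓ) (g : Hom) →
                  (⋁R S ⨾ g) ≐ (λ x z → ⋁ {Σ Hom S} (λ p → (proj₁ p ⨾ g) x z))
  ⨾-distribʳ-⋁R S g x z = begin
    ⋁ (λ y → ⋁ (λ p → proj₁ p x y) · g y z)   ≡⟨ ⋁-cong (λ y → ·-distribʳ-⋁ _ (g y z)) ⟩
    ⋁ (λ y → ⋁ (λ p → proj₁ p x y · g y z))   ≡⟨ ⋁-comm _ ⟩
    ⋁ (λ p → ⋁ (λ y → proj₁ p x y · g y z))   ∎
    where open ≡-Reasoning

  ⋁R-∈-′ : (B S : Pred Hom 0ℓ) → S ⊆ B ′ → ⋁R S ∈ B ′
  ⋁R-∈-′ B S S⊆B′ g g∈B x z = begin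
    (g ⨾ ⋁R S) x z                       ≡⟨ ⨾-distribˡ-⋁R g S x z ⟩
    ⋁ (λ p → (g ⨾ proj₁ p) x z)          ≡⟨ ⋁-cong (λ p → S⊆B′ (proj₂ p) g g∈B x z) ⟩
    ⋁ (λ p → (proj₁ p ⨾ g) x z)          ≡⟨ sym (⨾-distribʳ-⋁R S g x z) ⟩
    (⋁R S ⨾ g) x z                       ∎
    where open ≡-Reasoning

lemma23 : (Q : CIQuantale) (X : Set) (A : Pred (RelQ.Hom Q X) 0ℓ) →
          RelQ.IsVNAlg Q X A → RelQ.IsSubquantale Q X A
lemma23 Q X A isVN = ⋁R-closed , ⨾-closed , id∈
  where
  open RelQ Q X
  open CommutantLemmas Q X
  open IsVNAlg isVN

  ⋁R-closed : ∀ (S : Pred Hom 0ℓ) → (∀ f → f ∈ S → f ∈ A) → ⋁R S ∈ A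
  ⋁R-closed S S⊆A = vN⊇ (⋁R S) (⋁R-∈-′ (A ′) S (λ {f} f∈S → vN⊆ f (S⊆A f f∈S)))
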